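{- For every integer $n\ge0$, $\mathrm{val}(\triangle,n)\ge\mathrm{val}(n)$.
   Context: For an integer $n\ge0$, a triple $(A,B,C)$ of subsets of $\{0,\dots,n\}$ is equilateral trapezoid-free if for every fixed $a',b',c'$, each of the systems $n=a'+b+c=a+b'+c$; $n=a'+b+c=a+b+c'$; $n=a+b'+c=a+b+c'$ has at most one solution $(a,b,c)\in A\times B\times C$; $\mathrm{val}(n)$ is the maximum over such triples of the number of $(a,b,c)\in A\times B\times C$ with $a+b+c=n$. A triple $(A,B,C)$ of subsets of $\{0,\dots,n\}$ is triforce-free if there is no solution to $a+b+c'=a+b'+c=a'+b+c=n$ with $a,a'\in A$, $b,b'\in B$, $c,c'\in C$, $a\neq a'$, $b\neq b'$, $c\neq c'$; $\mathrm{val}(\triangle,n)$ (the paper's "triforce" value) is the maximum over triforce-free triples of the number of $(a,b,c)\in A\times B\times C$ with $a+b+c=n$. -}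

module Defs where

open import Data.Nat using (ℕ; zero; suc; _+_; _≤_)
open import Data.Nat.Properties using () renaming (_≟_ to _≟ℕ_)
open import Data.Fin using (Fin; toℕ)
import Data.Fin as Fin
open import Data.Fin.Subset using (Subset; _∈_)
open import Data.Fin.Subset.Properties using (_∈?_)
open import Data.Bool using (if_then_else_)
open import Data.Product using (_×_; Σ; ∃; _,_)
open import Relation.Nullary using (¬_; does)
open import Relation.Nullary.Decidable using (_×-dec_)
open import Relation.Binary.PropositionalEquality using (_≡_)

-- A subset of {0,…,n} is a Subset (suc n); the element i : Fin (suc n)
-- stands for the integer toℕ i.

sumFin : (m : ℕ) → (Fin m → ℕ) → ℕ
sumFin zero    f = 0
sumFin (suc m) f = f Fin.zero + sumFin m (λ i → f (Fin.suc i))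

count : (n : ℕ) → Subset (suc n) → Subset (suc n) → Subset (suc n) → ℕ
count n A B C =
  sumFin (suc n) λ a → sumFin (suc n) λ b → sumFin (suc n) λ c →
    if does ((a ∈? A) ×-dec ((b ∈? B) ×-dec ((c ∈? C) ×-dec
               ((toℕ a + toℕ b + toℕ c) ≟ℕ n))))
    then 1 else 0

AtMostOne : (n : ℕ) → Subset (suc n) → Subset (suc n) → Subset (suc n) →
            (Fin (suc n) → Fin (suc n) → Fin (suc n) → ℕ) →
            (Fin (suc n) → Fin (suc n) → Fin (suc n) → ℕ) → Set
AtMostOne n A B C e₁ e₂ =
  ∀ (a b c a₁ b₁ c₁ : Fin (suc n)) →
    a ∈ A → b ∈ B → c ∈ C → a₁ ∈ A → b₁ ∈ B → c₁ ∈ C →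
    e₁ a b c ≡ n → e₂ a b c ≡ n →
    e₁ a₁ b₁ c₁ ≡ n → e₂ a₁ b₁ c₁ ≡ n →
    (a ≡ a₁) × (b ≡ b₁) × (c ≡ c₁)

-- Equilateral-trapezoid-free: for every fixed a', b', c' each of the three
-- systems  n = a'+b+c = a+b'+c ;  n = a'+b+c = a+b+c' ;  n = a+b'+c = a+b+c'
-- has at most one solution (a,b,c) ∈ A×B×C.  (Fixed values a',b',c' range
-- over ℕ; values outside {0,…,n} admit no solutions anyway.)
ETFree : (n : ℕ) → Subset (suc n) → Subset (suc n) → Subset (suc n) → Set
ETFree n A B C =
  ∀ (a' b' c' : ℕ) →
    AtMostOne n A B C (λ a b c → a' + toℕ b + toℕ c) (λ a b c → toℕ a + b' + toℕ c)
  × AtMostOne n A B C (λ a b c → a' + toℕ b + toℕ c) (λ a b c → toℕ a + toℕ b + c')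
  × AtMostOne n A B C (λ a b c → toℕ a + b' + toℕ c) (λ a b c → toℕ a + toℕ b + c')

TriforceFree : (n : ℕ) → Subset (suc n) → Subset (suc n) → Subset (suc n) → Set
TriforceFree n A B C =
  ∀ (a a' b b' c c' : Fin (suc n)) →
    a ∈ A → a' ∈ A → b ∈ B → b' ∈ B → c ∈ C → c' ∈ C →
    ¬ (a ≡ a') → ¬ (b ≡ b') → ¬ (c ≡ c') →
    toℕ a + toℕ b + toℕ c' ≡ n →
    toℕ a + toℕ b' + toℕ c ≡ n →
    toℕ a' + toℕ b + toℕ c ≡ n →
    ⊥'
  where open import Data.Empty renaming (⊥ to ⊥')

IsMaxCount : (n : ℕ) → (Subset (suc n) → Subset (suc n) → Subset (suc n) → Set) → ℕ → Set
IsMaxCount n P v =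
  (Σ (Subset (suc n)) λ A → Σ (Subset (suc n)) λ B → Σ (Subset (suc n)) λ C →
     P A B C × count n A B C ≡ v)
  × (∀ A B C → P A B C → count n A B C ≤ v)

IsVal : ℕ → ℕ → Set
IsVal n v = IsMaxCount n (ETFree n) v

IsValTriforce : ℕ → ℕ → Set
IsValTriforce n v = IsMaxCount n (TriforceFree n) v

module Submission where

open import Defs
open import Data.Nat using (ℕ; suc; _≤_)
open import Data.Fin using (toℕ)
open import Data.Fin.Subset using (Subset)
open import Data.Product using (_,_; proj₁)
open import Relation.Binary.PropositionalEquality using (subst)

-- Given a triforce, fix a' := a and b' := b in the first trapezoid system
-- n = a'+x+z = x+b'+z.  Both (a,b,c') and (a',b',c) solve it, so uniqueness
-- forces a = a'.
etFree⇒triforceFree : ∀ n A B C → ETFree n A B C → TriforceFree n A B C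
etFree⇒triforceFree n A B C etFree a a' b b' c c' a∈A a'∈A b∈B b'∈B c∈C c'∈C
                    a≢a' _ _ abc'≡n ab'c≡n a'bc≡n =
  a≢a' (proj₁ (proj₁ (etFree (toℕ a) (toℕ b) 0)
    a b c' a' b' c a∈A b∈B c'∈C a'∈A b'∈B c∈C abc'≡n abc'≡n ab'c≡n a'bc≡n))

isMaxCount-mono : ∀ {n v w} {P Q : Subset (suc n) → Subset (suc n) → Subset (suc n) → Set} →
                  (∀ A B C → P A B C → Q A B C) →
                  IsMaxCount n P v → IsMaxCount n Q w → v ≤ w
isMaxCount-mono P⇒Q ((A , B , C , pABC , count≡v) , _) (_ , countQ≤w) =
  subst (_≤ _) count≡v (countQ≤w A B C (P⇒Q A B C pABC))

proposition4p11 : (n v w : ℕ) → IsVal n v → IsValTriforce n w → v ≤ w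
proposition4p11 n v w = isMaxCount-mono (etFree⇒triforceFree n)
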